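{- Let $Q=[Q_{y,x}]$ be an $s\times t$ $(0,1)$-matrix and let $m\ge s$, $n\ge t$ be integers. Then there exists a unique $m\times n$ $Q$-forcing $(0,1)$-matrix having the minimum possible number of $1$-entries among all $m\times n$ $Q$-forcing matrices. Moreover, this matrix equals the $m\times n$ matrix $W$ whose $(i,j)$-entry is $1$ if and only if there exist integers $a,b$ with $0\le a\le m-s$, $0\le b\le n-t$, $1\le i-a\le s$, $1\le j-b\le t$ and $Q_{i-a,\,j-b}=1$ (that is, $W$ is obtained from the all-zero matrix by setting to $1$, for every $s\times t$ submatrix formed by $s$ consecutive rows and $t$ consecutive columns, each entry that corresponds to a $1$-entry of $Q$).
   Context: All matrices are $(0,1)$-matrices. An $s\times t$ submatrix of an $m\times n$ matrix $A$ is obtained by choosing rows $r_1<\dots<r_s$ and columns $c_1<\dots<c_t$ (not necessarily consecutive) and keeping the entries in these rows and columns in their original order. For $m\ge s$, $n\ge t$, an $m\times n$ matrix $A$ is called $Q$-forcing if every $s\times t$ submatrix of $A$ can be transformed into $Q$ by turning some (possibly none) of its $1$-entries into $0$-entries, i.e. every $s\times t$ submatrix of $A$ is entrywise $\ge Q$. -}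

module Defs where

open import Data.Nat using (ℕ; _+_; _∸_; _≤_; _<_)
open import Data.Fin using (Fin; toℕ)
open import Data.Bool using (Bool; true; false)
open import Data.Product using (Σ; ∃; _×_)
open import Relation.Binary.PropositionalEquality using (_≡_)

Matrix : ℕ → ℕ → Set
Matrix m n = Fin m → Fin n → Bool

Increasing : ∀ {s m} → (Fin s → Fin m) → Set
Increasing {s} r = ∀ (y y′ : Fin s) → toℕ y < toℕ y′ → toℕ (r y) < toℕ (r y′)

submatrix : ∀ {m n s t} → Matrix m n → (Fin s → Fin m) → (Fin t → Fin n) → Matrix s t
submatrix A r c y x = A (r y) (c x)

_≥ᴹ_ : ∀ {s t} → Matrix s t → Matrix s t → Set
B ≥ᴹ Q = ∀ y x → Q y x ≡ true → B y x ≡ true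

Forcing : ∀ {s t m n} → Matrix s t → Matrix m n → Set
Forcing {s} {t} Q A =
  ∀ (r : Fin s → Fin _) (c : Fin t → Fin _) →
  Increasing r → Increasing c → submatrix A r c ≥ᴹ Q

sumFin : (k : ℕ) → (Fin k → ℕ) → ℕ
sumFin ℕ.zero f = 0
sumFin (ℕ.suc k) f = f Fin.zero + sumFin k (λ i → f (Fin.suc i))

bit : Bool → ℕ
bit true = 1
bit false = 0

ones : ∀ {m n} → Matrix m n → ℕ
ones {m} {n} A = sumFin m (λ i → sumFin n (λ j → bit (A i j)))

-- The defining condition of the (i,j)-entry of W (0-based translation of the
-- paper's 1-based condition): there are a ≤ m - s, b ≤ n - t and
-- y : Fin s, x : Fin t with i = a + y, j = b + x and Q y x = 1.
WEntry : ∀ {s t} (m n : ℕ) → Matrix s t → Fin m → Fin n → Set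
WEntry {s} {t} m n Q i j =
  Σ ℕ λ a → Σ ℕ λ b → Σ (Fin s) λ y → Σ (Fin t) λ x →
    (a ≤ m ∸ s) × (b ≤ n ∸ t) ×
    (toℕ i ≡ a + toℕ y) × (toℕ j ≡ b + toℕ x) × (Q y x ≡ true)

-- The rows hit by a strictly increasing r : Fin s → Fin m satisfy toℕ y ≤ toℕ (r y) and
-- toℕ (r y) ∸ toℕ y ≤ m ∸ s, so every entry of an s × t submatrix sits inside some window
-- of s consecutive rows and t consecutive columns at the same relative position.  Hence W,
-- the union of the copies of Q in all consecutive windows, is Q-forcing.  Conversely each
-- 1 of W is a 1 of Q in a consecutive window, which is itself a submatrix, so every
-- Q-forcing B satisfies B ≥ W entrywise: W has the fewest 1s, and a B with as few 1s
-- must coincide with W.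
module Submission where

open import Defs
open import Data.Nat using (ℕ; zero; suc; _+_; _∸_; _≤_; _<_; z≤n; s≤s; _≤?_)
open import Data.Nat.Properties
open import Data.Bool using (Bool; true; false)
open import Data.Bool.Properties using (T-≡) renaming (_≟_ to _≟ᴮ_)
open import Data.Fin using (Fin; toℕ; fromℕ<; inject₁) renaming (zero to fzero; suc to fsuc)
open import Data.Fin.Properties using (toℕ-fromℕ<; toℕ-injective; toℕ-inject₁; toℕ<n; any?)
open import Data.Product using (Σ; _×_; _,_)
open import Function.Bundles using (_⇔_; mk⇔; Equivalence)
open import Function.Construct.Composition using (_⇔-∘_)
open import Relation.Nullary using (Dec)
open import Relation.Nullary.Decidable using (_×-dec_; isYes; toWitness; fromWitness)
open import Relation.Binary.PropositionalEquality

private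
  variable
    k s m n M : ℕ

Increasing-∘inject₁ : (r : Fin (suc s) → Fin m) → Increasing r → Increasing (λ y → r (inject₁ y))
Increasing-∘inject₁ r r↑ y y′ y<y′ =
  r↑ (inject₁ y) (inject₁ y′) (subst₂ _<_ (sym (toℕ-inject₁ y)) (sym (toℕ-inject₁ y′)) y<y′)

Increasing-∘suc : (r : Fin (suc s) → Fin m) → Increasing r → Increasing (λ y → r (fsuc y))
Increasing-∘suc r r↑ y y′ y<y′ = r↑ (fsuc y) (fsuc y′) (s≤s y<y′)

Increasing⇒toℕ≤ : (r : Fin s → Fin m) → Increasing r → ∀ y → toℕ y ≤ toℕ (r y)
Increasing⇒toℕ≤ r r↑ fzero = z≤n
Increasing⇒toℕ≤ {suc s} r r↑ (fsuc y) = begin-strict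
  toℕ y                   ≤⟨ Increasing⇒toℕ≤ _ (Increasing-∘inject₁ r r↑) y ⟩
  toℕ (r (inject₁ y))     <⟨ r↑ (inject₁ y) (fsuc y) (s≤s (≤-reflexive (toℕ-inject₁ y))) ⟩
  toℕ (r (fsuc y))        ∎
  where open ≤-Reasoning

-- The s ∸ toℕ y indices y, …, s − 1 are sent strictly increasingly into r y, …, m − 1.
Increasing⇒room-above : (r : Fin s → Fin m) → Increasing r → ∀ y → toℕ (r y) + (s ∸ toℕ y) ≤ m
Increasing⇒room-above {suc zero} {m} r r↑ fzero =
  subst (_≤ m) (+-comm 1 (toℕ (r fzero))) (toℕ<n (r fzero))
Increasing⇒room-above {suc (suc s)} {m} r r↑ fzero = begin
  toℕ (r fzero) + suc (suc s)   ≡⟨ +-suc (toℕ (r fzero)) (suc s) ⟩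
  suc (toℕ (r fzero)) + suc s   ≤⟨ +-monoˡ-≤ (suc s) (r↑ fzero (fsuc fzero) (s≤s z≤n)) ⟩
  toℕ (r (fsuc fzero)) + suc s  ≤⟨ Increasing⇒room-above _ (Increasing-∘suc r r↑) fzero ⟩
  m                             ∎
  where open ≤-Reasoning
Increasing⇒room-above {suc s} r r↑ (fsuc y) = Increasing⇒room-above _ (Increasing-∘suc r r↑) y

-- Row y of a k-row pattern can be placed at row i of an M-row matrix by a window of k
-- consecutive rows; the window then starts at row toℕ i ∸ toℕ y.
Placeable : (k M : ℕ) → Fin k → Fin M → Set
Placeable k M y i = toℕ y ≤ toℕ i × toℕ i ∸ toℕ y ≤ M ∸ k

placeable? : (y : Fin k) (i : Fin M) → Dec (Placeable k M y i)
placeable? {k} {M} y i = (toℕ y ≤? toℕ i) ×-dec (toℕ i ∸ toℕ y ≤? M ∸ k)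

Increasing⇒Placeable : (r : Fin k → Fin M) → Increasing r → ∀ y → Placeable k M y (r y)
Increasing⇒Placeable {k} {M} r r↑ y = y≤ry , m+n≤o⇒m≤o∸n (toℕ (r y) ∸ toℕ y) room
  where
  y≤ry = Increasing⇒toℕ≤ r r↑ y
  y≤k = <⇒≤ (toℕ<n y)
  room : toℕ (r y) ∸ toℕ y + k ≤ M
  room = subst (_≤ M)
    (trans (sym (+-∸-assoc (toℕ (r y)) y≤k)) (+-∸-comm k y≤ry))
    (Increasing⇒room-above r r↑ y)

Placeable⇒offset : ∀ y i → Placeable k M y i → Σ ℕ λ a → a ≤ M ∸ k × toℕ i ≡ a + toℕ y
Placeable⇒offset y i (y≤i , a≤) = toℕ i ∸ toℕ y , a≤ , sym (m∸n+n≡m y≤i)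

offset⇒Placeable : ∀ (y : Fin k) (i : Fin M) a → a ≤ M ∸ k → toℕ i ≡ a + toℕ y →
                   Placeable k M y i
offset⇒Placeable y i a a≤ i≡a+y rewrite i≡a+y =
  m≤n+m (toℕ y) a , subst (_≤ _) (sym (m+n∸n≡m a (toℕ y))) a≤

window : (a : ℕ) → a ≤ M ∸ k → k ≤ M → Fin k → Fin M
window {M} {k} a a≤ k≤M z = fromℕ< (begin-strict
  a + toℕ z  <⟨ +-monoʳ-< a (toℕ<n z) ⟩
  a + k      ≤⟨ +-monoˡ-≤ k a≤ ⟩
  M ∸ k + k  ≡⟨ m∸n+n≡m k≤M ⟩
  M          ∎)
  where open ≤-Reasoning

toℕ-window : ∀ a (a≤ : a ≤ M ∸ k) (k≤M : k ≤ M) z → toℕ (window a a≤ k≤M z) ≡ a + toℕ z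
toℕ-window a a≤ k≤M z = toℕ-fromℕ< _

window-increasing : ∀ a (a≤ : a ≤ M ∸ k) (k≤M : k ≤ M) → Increasing (window a a≤ k≤M)
window-increasing a a≤ k≤M z z′ z<z′ =
  subst₂ _<_ (sym (toℕ-window a a≤ k≤M z)) (sym (toℕ-window a a≤ k≤M z′)) (+-monoʳ-< a z<z′)

Placeable⇒window : k ≤ M → ∀ y i → Placeable k M y i →
                   Σ (Fin k → Fin M) λ r → Increasing r × r y ≡ i
Placeable⇒window k≤M y i (y≤i , a≤) =
  window a a≤ k≤M , window-increasing a a≤ k≤M ,
  toℕ-injective (trans (toℕ-window a a≤ k≤M y) (m∸n+n≡m y≤i))
  where a = toℕ i ∸ toℕ y

module MinimalForcing {s t} (Q : Matrix s t) (m n : ℕ) where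

  Covered : Fin m → Fin n → Set
  Covered i j = Σ (Fin s) λ y → Σ (Fin t) λ x →
    Q y x ≡ true × Placeable s m y i × Placeable t n x j

  covered? : ∀ i j → Dec (Covered i j)
  covered? i j = any? λ y → any? λ x →
    (Q y x ≟ᴮ true) ×-dec placeable? y i ×-dec placeable? x j

  W : Matrix m n
  W i j = isYes (covered? i j)

  W-true⇔Covered : ∀ i j → W i j ≡ true ⇔ Covered i j
  W-true⇔Covered i j = mk⇔
    (λ w → toWitness (Equivalence.from T-≡ w))
    (λ c → Equivalence.to T-≡ (fromWitness c))

  Covered⇔WEntry : ∀ i j → Covered i j ⇔ WEntry m n Q i j
  Covered⇔WEntry i j = mk⇔ to from
    where
    to : Covered i j → WEntry m n Q i j
    to (y , x , q , py , px) with Placeable⇒offset y i py | Placeable⇒offset x j px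
    ... | a , a≤ , i≡ | b , b≤ , j≡ = a , b , y , x , a≤ , b≤ , i≡ , j≡ , q
    from : WEntry m n Q i j → Covered i j
    from (a , b , y , x , a≤ , b≤ , i≡ , j≡ , q) =
      y , x , q , offset⇒Placeable y i a a≤ i≡ , offset⇒Placeable x j b b≤ j≡

  W-forcing : Forcing Q W
  W-forcing r c r↑ c↑ y x q = Equivalence.from (W-true⇔Covered (r y) (c x))
    (y , x , q , Increasing⇒Placeable r r↑ y , Increasing⇒Placeable c c↑ x)

  Forcing⇒≥ᴹW : s ≤ m → t ≤ n → ∀ (B : Matrix m n) → Forcing Q B → B ≥ᴹ W
  Forcing⇒≥ᴹW s≤m t≤n B B-forcing i j w
    with Equivalence.to (W-true⇔Covered i j) w
  ... | y , x , q , py , px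
    with Placeable⇒window s≤m y i py | Placeable⇒window t≤n x j px
  ... | r , r↑ , refl | c , c↑ , refl = B-forcing r c r↑ c↑ y x q

sumFin-mono-≤ : ∀ k (f g : Fin k → ℕ) → (∀ i → f i ≤ g i) → sumFin k f ≤ sumFin k g
sumFin-mono-≤ zero f g f≤g = z≤n
sumFin-mono-≤ (suc k) f g f≤g = +-mono-≤ (f≤g fzero) (sumFin-mono-≤ k _ _ (λ i → f≤g (fsuc i)))

+-mono-≤-≡⇒≡ : ∀ {a b c d} → a ≤ c → b ≤ d → a + b ≡ c + d → a ≡ c × b ≡ d
+-mono-≤-≡⇒≡ {a} {b} {c} {d} a≤c b≤d a+b≡c+d = a≡c , b≡d
  where
  a≡c : a ≡ c
  a≡c = ≤-antisym a≤c (+-cancelʳ-≤ d c a (begin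
    c + d  ≡⟨ a+b≡c+d ⟨
    a + b  ≤⟨ +-monoʳ-≤ a b≤d ⟩
    a + d  ∎))
    where open ≤-Reasoning
  b≡d : b ≡ d
  b≡d = +-cancelˡ-≡ a b d (trans a+b≡c+d (cong (_+ d) (sym a≡c)))

sumFin-≡⇒≗ : ∀ k (f g : Fin k → ℕ) → (∀ i → f i ≤ g i) → sumFin k f ≡ sumFin k g → ∀ i → f i ≡ g i
sumFin-≡⇒≗ (suc k) f g f≤g Σf≡Σg i
  with +-mono-≤-≡⇒≡ (f≤g fzero) (sumFin-mono-≤ k _ _ (λ i → f≤g (fsuc i))) Σf≡Σg
sumFin-≡⇒≗ (suc k) f g f≤g Σf≡Σg fzero    | head≡ , _ = head≡
sumFin-≡⇒≗ (suc k) f g f≤g Σf≡Σg (fsuc i) | _ , tail≡ =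
  sumFin-≡⇒≗ k _ _ (λ i → f≤g (fsuc i)) tail≡ i

bit-mono : ∀ {a b : Bool} → (a ≡ true → b ≡ true) → bit a ≤ bit b
bit-mono {false} _ = z≤n
bit-mono {true} a⇒b rewrite a⇒b refl = ≤-refl

bit-injective : ∀ {a b : Bool} → bit a ≡ bit b → a ≡ b
bit-injective {false} {false} _ = refl
bit-injective {true} {true} _ = refl

≥ᴹ⇒ones≤ : (A B : Matrix m n) → B ≥ᴹ A → ones A ≤ ones B
≥ᴹ⇒ones≤ {m} {n} A B B≥A =
  sumFin-mono-≤ m _ _ (λ i → sumFin-mono-≤ n _ _ (λ j → bit-mono (B≥A i j)))

≥ᴹ∧ones≡⇒≡ : (A B : Matrix m n) → B ≥ᴹ A → ones B ≡ ones A → ∀ i j → B i j ≡ A i j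
≥ᴹ∧ones≡⇒≡ {m} {n} A B B≥A ones≡ i j =
  sym (bit-injective (sumFin-≡⇒≗ n _ _ (entry≤ i) (row-sums≡ i) j))
  where
  entry≤ : ∀ i j → bit (A i j) ≤ bit (B i j)
  entry≤ i j = bit-mono (B≥A i j)
  row-sums≡ : ∀ i → sumFin n (λ j → bit (A i j)) ≡ sumFin n (λ j → bit (B i j))
  row-sums≡ = sumFin-≡⇒≗ m _ _ (λ i → sumFin-mono-≤ n _ _ (entry≤ i)) (sym ones≡)

lemma1 : ∀ {s t} (Q : Matrix s t) (m n : ℕ) → s ≤ m → t ≤ n →
    Σ (Matrix m n) λ W →
      Forcing Q W
      × (∀ (B : Matrix m n) → Forcing Q B → ones W ≤ ones B)
      × (∀ (B : Matrix m n) → Forcing Q B → ones B ≡ ones W → ∀ i j → B i j ≡ W i j)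
      × (∀ i j → (W i j ≡ true) ⇔ WEntry m n Q i j)
lemma1 Q m n s≤m t≤n =
  W , W-forcing ,
  (λ B B-forcing → ≥ᴹ⇒ones≤ W B (Forcing⇒≥ᴹW s≤m t≤n B B-forcing)) ,
  (λ B B-forcing → ≥ᴹ∧ones≡⇒≡ W B (Forcing⇒≥ᴹW s≤m t≤n B B-forcing)) ,
  (λ i j → Covered⇔WEntry i j ⇔-∘ W-true⇔Covered i j)
  where open MinimalForcing Q m n
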